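{- Let $(\Gamma,X,\mathcal B)\in\mathcal G$ and $B\in\mathcal B$. If $m^*(\Gamma,\mathcal B)=1$ and $m(\mathcal D(B))=1$, then $X_B^B\cong X_B^{\Gamma_{\mathcal B}(B)}$.
   Context: Graphs are finite, simple, undirected. $X$-symmetric: $X$ acts preserving adjacency, transitively on vertices and on arcs. For an $X$-invariant partition $\mathcal B$ of $V(\Gamma)$: $\Gamma_{\mathcal B}$ is the quotient graph on $\mathcal B$ ($B\sim C$ iff some vertex of $B$ is adjacent to some vertex of $C$), $\Gamma_{\mathcal B}(B)$ the neighbourhood of $B$ in it; $\Gamma(C)=\bigcup_{\mathfrak u\in C}\Gamma(\mathfrak u)$; $\Gamma_{\mathcal B}(\mathfrak v)=\{C\in\mathcal B:\mathfrak v\in\Gamma(C)\}$. $\mathcal D(B)$ is the incidence structure with points $B$, blocks $\Gamma_{\mathcal B}(B)$, $\mathfrak v$ incident with $C$ iff $C\in\Gamma_{\mathcal B}(\mathfrak v)$. $m(\mathcal D(B))$ is the number of blocks $C'\in\Gamma_{\mathcal B}(B)$ with $\Gamma(C')\cap B=\Gamma(C)\cap B$ for a given $C$ (a constant). $m^*(\Gamma,\mathcal B)=|B\cap\bigcap_{C\in\Gamma_{\mathcal B}(\mathfrak v)}\Gamma(C)|$ for $\mathfrak v\in B$ (a constant). $X_B^B=X_B/X_{(B)}$ and $X_B^{\Gamma_{\mathcal B}(B)}$ are the permutation groups induced by the setwise stabiliser $X_B$ on $B$ and on $\Gamma_{\mathcal B}(B)$. $\Gamma$ is a multicover of $\Gamma_{\mathcal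 B}$ if $|\Gamma(C)\cap B|=|B|$ for adjacent $B,C$. $\mathcal G$ is the set of triples $(\Gamma,X,\mathcal B)$ with $\Gamma$ finite $X$-symmetric, $\mathcal B$ an $X$-invariant partition with $1<|B|<|V(\Gamma)|$, $val(\Gamma_{\mathcal B})\ge2$, $\Gamma$ not a multicover of $\Gamma_{\mathcal B}$. -}

module Defs where

open import Level using (Level; _⊔_)
open import Data.Bool using (Bool; true; false; T; _∧_; not; if_then_else_)
open import Data.Nat using (ℕ; _<_; _≤_)
open import Data.Fin using (Fin; _≟_)
open import Data.List using (List; length; filterᵇ; allFin)
open import Data.Bool.ListAction using (all; any)
open import Data.Product using (Σ; _×_; _,_; ∃)
open import Relation.Nullary using (¬_)
open import Relation.Nullary.Decidable using (⌊_⌋)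
open import Relation.Binary.PropositionalEquality using (_≡_)
open import Function.Bundles using (_⇔_)
open import Algebra.Bundles using (Group)

count : ∀ {m} → (Fin m → Bool) → ℕ
count {m} p = length (filterᵇ p (allFin m))

_==_ : ∀ {m} → Fin m → Fin m → Bool
a == b = ⌊ a ≟ b ⌋

_⇒ᵇ_ : Bool → Bool → Bool
a ⇒ᵇ b = not a Data.Bool.∨ b

_⇔ᵇ_ : Bool → Bool → Bool
true ⇔ᵇ b = b
false ⇔ᵇ b = not b

record SimpleGraph (n : ℕ) : Set where
  field
    adj   : Fin n → Fin n → Bool
    sym   : ∀ u v → adj u v ≡ adj v u
    irrefl : ∀ u → adj u u ≡ false

record Action {c ℓ : Level} (X : Group c ℓ) (n : ℕ) : Set (c ⊔ ℓ) where
  open Group X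
  field
    act      : Carrier → Fin n → Fin n
    act-cong : ∀ {g h} → g ≈ h → ∀ u → act g u ≡ act h u
    act-ε    : ∀ u → act ε u ≡ u
    act-∙    : ∀ g h u → act (g ∙ h) u ≡ act g (act h u)

record IsSymmetric {c ℓ : Level} {n : ℕ} (Γ : SimpleGraph n) (X : Group c ℓ)
                   (A : Action X n) : Set c where
  open SimpleGraph Γ
  open Action A
  open Group X using (Carrier)
  field
    preserves   : ∀ g u v → adj (act g u) (act g v) ≡ adj u v
    vertexTrans : ∀ u v → ∃ λ g → act g u ≡ v
    arcTrans    : ∀ u v u' v' → T (adj u v) → T (adj u' v') →
                  ∃ λ g → (act g u ≡ u') × (act g v ≡ v')

-- An X-invariant partition of Fin n into k blocks, given by a surjective
-- labelling blk : Fin n → Fin k (the blocks are the fibres of blk).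
record InvPartition {c ℓ : Level} {n : ℕ} (X : Group c ℓ) (A : Action X n)
                    (k : ℕ) : Set c where
  open Action A
  field
    blk       : Fin n → Fin k
    surj      : ∀ (B : Fin k) → ∃ λ u → blk u ≡ B
    invariant : ∀ g u v → blk u ≡ blk v → blk (act g u) ≡ blk (act g v)

module Quotient {n k : ℕ} (Γ : SimpleGraph n) (blk : Fin n → Fin k) where
  open SimpleGraph Γ

  inB : Fin k → Fin n → Bool
  inB B u = blk u == B

  size : Fin k → ℕ
  size B = count (inB B)

  inΓ : Fin k → Fin n → Bool
  inΓ C v = any (λ u → inB C u ∧ adj u v) (allFin n)

  qadj : Fin k → Fin k → Bool
  qadj B C = not (B == C) ∧ any (λ u → inB B u ∧ inΓ C u) (allFin n)

  qval : Fin k → ℕ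
  qval B = count (qadj B)

  traceSize : Fin k → Fin k → ℕ
  traceSize B C = count (λ u → inB B u ∧ inΓ C u)

  Multicover : Set
  Multicover = ∀ B C → T (qadj B C) → traceSize B C ≡ size B

  -- m*(Γ,𝓑) computed at the vertex v (with B the block of v):
  -- |B ∩ ⋂_{C ∈ Γ_𝓑(v)} Γ(C)|, where Γ_𝓑(v) = {C : v ∈ Γ(C)}
  mStar : Fin n → ℕ
  mStar v = count (λ u → inB (blk v) u ∧
                          all (λ C → inΓ C v ⇒ᵇ inΓ C u) (allFin k))

  -- m(𝓓(B)) computed at the block C ∈ Γ_𝓑(B): the number of blocks
  -- C' ∈ Γ_𝓑(B) with Γ(C') ∩ B = Γ(C) ∩ B
  mD : Fin k → Fin k → ℕ
  mD B C = count (λ C' → qadj B C' ∧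
                   all (λ u → inB B u ⇒ᵇ (inΓ C' u ⇔ᵇ inΓ C u)) (allFin n))

record InG {c ℓ : Level} {n : ℕ} (Γ : SimpleGraph n) (X : Group c ℓ)
           (A : Action X n) {k : ℕ} (P : InvPartition X A k) : Set c where
  open InvPartition P
  open Quotient Γ blk
  field
    symmetric    : IsSymmetric Γ X A
    nontrivial   : ∀ B → 1 < size B × size B < n
    valency      : ∀ B → 2 ≤ qval B
    notMulticover : ¬ Multicover

module Induced {c ℓ : Level} {n : ℕ} (Γ : SimpleGraph n) (X : Group c ℓ)
               (A : Action X n) {k : ℕ} (P : InvPartition X A k) (B : Fin k) where
  open Group X
  open Action A
  open InvPartition P
  open Quotient Γ blk

  Stab : Carrier → Set
  Stab g = ∀ u → (blk u ≡ B) ⇔ (blk (act g u) ≡ B)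

  _≈B_ : Carrier → Carrier → Set
  g ≈B h = ∀ u → blk u ≡ B → act g u ≡ act h u

  -- g, h ∈ X_B induce the same permutation of Γ_𝓑(B)
  -- (g maps the block C = blk u to the block blk (act g u))
  _≈N_ : Carrier → Carrier → Set
  g ≈N h = ∀ u → T (qadj B (blk u)) → blk (act g u) ≡ blk (act h u)

  -- X_B^B ≅ X_B^{Γ_𝓑(B)} as abstract groups: each induced group is X_B
  -- modulo the corresponding kernel (elements equal iff they induce the
  -- same permutation); an isomorphism is a well-defined, bijective
  -- homomorphism between these quotients.
  record InducedIso : Set (c ⊔ ℓ) where
    field
      φ      : Carrier → Carrier
      φ-stab : ∀ g → Stab g → Stab (φ g)
      φ-cong : ∀ g h → Stab g → Stab h → g ≈B h → φ g ≈N φ h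
      φ-hom  : ∀ g h → Stab g → Stab h → φ (g ∙ h) ≈N (φ g ∙ φ h)
      φ-inj  : ∀ g h → Stab g → Stab h → φ g ≈N φ h → g ≈B h
      φ-surj : ∀ h → Stab h → Σ Carrier λ g → Stab g × (φ g ≈N h)

module Submission where

-- Both induced groups are quotients of the stabiliser X_B, by the kernel of
-- its action on B and on Γ_𝓑(B) respectively.  So the identity of X_B
-- induces the required isomorphism as soon as the two kernels coincide,
-- i.e. for g, h ∈ X_B:   g ≈B h  ⇔  g ≈N h.
--
--  * m(𝓓(B)) = 1 says a block C ∈ Γ_𝓑(B) is determined by its trace
--    Γ(C) ∩ B.  If g and h agree on B, then gC and hC have the same trace
--    on B (namely g(Γ(C) ∩ B) = h(Γ(C) ∩ B)), hence gC = hC.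
--  * m*(Γ,𝓑) = 1 says a vertex v is determined inside its block by the
--    set Γ_𝓑(v) of blocks whose neighbourhood contains it.  If g and h agree
--    on Γ_𝓑(B) (and both fix B), then for u ∈ B every block in Γ_𝓑(gu) also
--    lies in Γ_𝓑(hu), so gu = hu.

open import Defs
open import Level using (Level)
open import Data.Nat using (ℕ)
open import Data.Fin using (Fin; _≟_)
open import Data.Bool using (Bool; true; false; T; _∧_; not)
open import Data.Bool.Properties using (T-∧)
open import Data.Bool.ListAction using (all; any)
open import Data.List using (List; []; _∷_; length; filterᵇ; allFin)
open import Data.List.Relation.Unary.Any using (here; satisfied)
import Data.List.Relation.Unary.All as All
open import Data.List.Relation.Unary.All.Properties using (all⁻)
open import Data.List.Relation.Unary.Any.Properties using (any⁺; any⁻)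
open import Data.List.Membership.Propositional using (_∈_; lose)
open import Data.List.Membership.Propositional.Properties using (∈-allFin; ∈-filter⁺)
open import Data.Product using (Σ; _×_; _,_)
open import Data.Unit using (tt)
open import Relation.Nullary using (¬_; yes; no)
open import Relation.Nullary.Decidable using (T?; toWitness; fromWitness)
open import Relation.Binary.PropositionalEquality
  using (_≡_; refl; sym; trans; cong; subst; subst₂; module ≡-Reasoning)
open import Function.Base using (_∘_)
open import Function.Bundles using (Equivalence)
open import Algebra.Bundles using (Group)

length≡1⇒unique : ∀ {A : Set} {xs : List A} {a b} →
                  length xs ≡ 1 → a ∈ xs → b ∈ xs → a ≡ b
length≡1⇒unique {xs = x ∷ []} refl (here refl) (here refl) = refl

count≡1⇒unique : ∀ {m} (p : Fin m → Bool) {a b} →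
                 count p ≡ 1 → T (p a) → T (p b) → a ≡ b
count≡1⇒unique {m} p {a} {b} p₁ pa pb =
  length≡1⇒unique p₁ (member a pa) (member b pb)
  where
  member : ∀ x → T (p x) → x ∈ filterᵇ p (allFin m)
  member x px = ∈-filter⁺ {P = T ∘ p} (T? ∘ p) (∈-allFin x) px

∧-intro : ∀ {a b} → T a → T b → T (a ∧ b)
∧-intro ta tb = Equivalence.from T-∧ (ta , tb)

⇒ᵇ-intro : ∀ {a b} → (T a → T b) → T (a ⇒ᵇ b)
⇒ᵇ-intro {true}  f = f tt
⇒ᵇ-intro {false} f = tt

⇔ᵇ-intro : ∀ {a b} → (T a → T b) → (T b → T a) → T (a ⇔ᵇ b)
⇔ᵇ-intro {true}  {true}  f g = tt
⇔ᵇ-intro {true}  {false} f g = f tt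
⇔ᵇ-intro {false} {true}  f g = g tt
⇔ᵇ-intro {false} {false} f g = tt

≢-intro : ∀ {m} {a b : Fin m} → ¬ a ≡ b → T (not (a == b))
≢-intro {a = a} {b} a≢b with a ≟ b
... | yes a≡b = a≢b a≡b
... | no _    = tt

≢-elim : ∀ {m} {a b : Fin m} → T (not (a == b)) → ¬ a ≡ b
≢-elim {a = a} {b} t a≡b with a ≟ b
... | yes _   = t
... | no a≢b  = a≢b a≡b

all-intro : ∀ {m} (p : Fin m → Bool) → (∀ x → T (p x)) → T (all p (allFin m))
all-intro {m} p f = all⁻ p {xs = allFin m} (All.tabulate (λ {x} _ → f x))

any-intro : ∀ {m} (p : Fin m → Bool) x → T (p x) → T (any p (allFin m))
any-intro p x px = any⁺ p (lose (∈-allFin x) px)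

any-elim : ∀ {m} (p : Fin m → Bool) → T (any p (allFin m)) → Σ (Fin m) λ x → T (p x)
any-elim {m} p t = satisfied (any⁻ p (allFin m) t)

module Neighbourhoods {n k : ℕ} (Γ : SimpleGraph n) (blk : Fin n → Fin k) where
  open SimpleGraph Γ using (adj)
  open Quotient Γ blk

  inΓ-intro : ∀ {C u v} → blk u ≡ C → T (adj u v) → T (inΓ C v)
  inΓ-intro {C} {u} {v} u∈C uv =
    any-intro (λ w → inB C w ∧ adj w v) u (∧-intro (fromWitness u∈C) uv)

  inΓ-elim : ∀ {C v} → T (inΓ C v) → Σ (Fin n) λ u → (blk u ≡ C) × T (adj u v)
  inΓ-elim {C} {v} t with any-elim (λ w → inB C w ∧ adj w v) t
  ... | u , t′ with Equivalence.to T-∧ t′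
  ...   | u∈C , uv = u , toWitness u∈C , uv

  qadj-intro : ∀ {B C} u → blk u ≡ B → T (inΓ C u) → ¬ C ≡ B → T (qadj B C)
  qadj-intro {B} {C} u u∈B u∈ΓC C≢B =
    ∧-intro (≢-intro (λ B≡C → C≢B (sym B≡C)))
            (any-intro (λ w → inB B w ∧ inΓ C w) u (∧-intro (fromWitness u∈B) u∈ΓC))

  qadj-elim : ∀ {B C} → T (qadj B C) →
              (¬ C ≡ B) × Σ (Fin n) λ u → (blk u ≡ B) × T (inΓ C u)
  qadj-elim {B} {C} t with Equivalence.to T-∧ t
  ... | B≢C , meets with any-elim (λ w → inB B w ∧ inΓ C w) meets
  ...   | u , t′ with Equivalence.to T-∧ t′
  ...     | u∈B , u∈ΓC =
    (λ C≡B → ≢-elim B≢C (sym C≡B)) , u , toWitness u∈B , u∈ΓC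

  determined-by-Γ𝓑 : ∀ {v w} → mStar v ≡ 1 → blk w ≡ blk v →
                     (∀ C → T (inΓ C v) → T (inΓ C w)) → w ≡ v
  determined-by-Γ𝓑 {v} {w} m*≡1 w∼v Γ𝓑v⊆Γ𝓑w =
    count≡1⇒unique common m*≡1 (common-at w∼v Γ𝓑v⊆Γ𝓑w) (common-at refl λ _ i → i)
    where
    common : Fin n → Bool
    common u = inB (blk v) u ∧ all (λ C → inΓ C v ⇒ᵇ inΓ C u) (allFin k)
    common-at : ∀ {u} → blk u ≡ blk v → (∀ C → T (inΓ C v) → T (inΓ C u)) → T (common u)
    common-at u∼v incl = ∧-intro (fromWitness u∼v) (all-intro _ λ C → ⇒ᵇ-intro (incl C))

  determined-by-trace : ∀ {B C C′} → mD B C ≡ 1 → T (qadj B C) → T (qadj B C′) →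
                        (∀ u → blk u ≡ B → T (inΓ C′ u) → T (inΓ C u)) →
                        (∀ u → blk u ≡ B → T (inΓ C u) → T (inΓ C′ u)) → C′ ≡ C
  determined-by-trace {B} {C} {C′} m≡1 BC BC′ C′⊆C C⊆C′ =
    count≡1⇒unique sameTrace m≡1 (sameTrace-at BC′ C′⊆C C⊆C′)
                   (sameTrace-at BC (λ _ _ i → i) (λ _ _ i → i))
    where
    sameTrace : Fin k → Bool
    sameTrace D = qadj B D ∧ all (λ u → inB B u ⇒ᵇ (inΓ D u ⇔ᵇ inΓ C u)) (allFin n)
    sameTrace-at : ∀ {D} → T (qadj B D) →
                   (∀ u → blk u ≡ B → T (inΓ D u) → T (inΓ C u)) →
                   (∀ u → blk u ≡ B → T (inΓ C u) → T (inΓ D u)) → T (sameTrace D)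
    sameTrace-at BD D⊆C C⊆D = ∧-intro BD (all-intro _ λ u → ⇒ᵇ-intro λ u∈B →
      ⇔ᵇ-intro (D⊆C u (toWitness u∈B)) (C⊆D u (toWitness u∈B)))

module StabiliserAction {c ℓ : Level} {n k : ℕ} (Γ : SimpleGraph n) (X : Group c ℓ)
    (A : Action X n) (P : InvPartition X A k)
    (preserves : ∀ g u v → SimpleGraph.adj Γ (Action.act A g u) (Action.act A g v)
                           ≡ SimpleGraph.adj Γ u v)
    (B : Fin k) where
  open Group X using (_∙_; ε; _⁻¹; inverseˡ; inverseʳ)
  open ≡-Reasoning
  open Action A
  open InvPartition P using (blk; invariant)
  open SimpleGraph Γ using (adj)
  open Quotient Γ blk
  open Neighbourhoods Γ blk
  open Induced Γ X A P B

  act-inverseˡ : ∀ g x → act (g ⁻¹) (act g x) ≡ x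
  act-inverseˡ g x = begin
    act (g ⁻¹) (act g x) ≡⟨ act-∙ (g ⁻¹) g x ⟨
    act (g ⁻¹ ∙ g) x     ≡⟨ act-cong (inverseˡ g) x ⟩
    act ε x              ≡⟨ act-ε x ⟩
    x                    ∎

  act-inverseʳ : ∀ g x → act g (act (g ⁻¹) x) ≡ x
  act-inverseʳ g x = begin
    act g (act (g ⁻¹) x) ≡⟨ act-∙ g (g ⁻¹) x ⟨
    act (g ∙ g ⁻¹) x     ≡⟨ act-cong (inverseʳ g) x ⟩
    act ε x              ≡⟨ act-ε x ⟩
    x                    ∎

  adj-preserved : ∀ g {x y} → T (adj x y) → T (adj (act g x) (act g y))
  adj-preserved g {x} {y} = subst T (sym (preserves g x y))

  inΓ-preserved : ∀ g {x y} → T (inΓ (blk x) y) → T (inΓ (blk (act g x)) (act g y))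
  inΓ-preserved g {x} t with inΓ-elim t
  ... | u , u∼x , uy = inΓ-intro (invariant g u x u∼x) (adj-preserved g uy)

  inΓ-reflected : ∀ g {x y} → T (inΓ (blk (act g x)) (act g y)) → T (inΓ (blk x) y)
  inΓ-reflected g {x} {y} t =
    subst₂ (λ a b → T (inΓ (blk a) b)) (act-inverseˡ g x) (act-inverseˡ g y) (inΓ-preserved (g ⁻¹) t)

  Γ𝓑B-preserved : ∀ g → Stab g → ∀ x → T (qadj B (blk x)) → T (qadj B (blk (act g x)))
  Γ𝓑B-preserved g g∈X_B x BC with qadj-elim BC
  ... | C≢B , u , u∈B , u∈ΓC =
    qadj-intro (act g u) (Equivalence.to (g∈X_B u) u∈B) (inΓ-preserved g u∈ΓC)
               (λ gC≡B → C≢B (Equivalence.from (g∈X_B x) gC≡B))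

  -- If g, h ∈ X_B agree on B, then for x in a block C they map the trace
  -- Γ(C) ∩ B to the same set, so Γ(gC) ∩ B ⊆ Γ(hC) ∩ B.
  trace-transport : ∀ {g h} → Stab g → g ≈B h → ∀ x u → blk u ≡ B →
                    T (inΓ (blk (act g x)) u) → T (inΓ (blk (act h x)) u)
  trace-transport {g} {h} g∈X_B g≈h x u u∈B u∈ΓgC =
    subst (λ z → T (inΓ (blk (act h x)) z)) hu₀≡u (inΓ-preserved h u₀∈ΓC)
    where
    u₀ = act (g ⁻¹) u
    gu₀≡u : act g u₀ ≡ u
    gu₀≡u = act-inverseʳ g u
    u₀∈B : blk u₀ ≡ B
    u₀∈B = Equivalence.from (g∈X_B u₀) (subst (λ z → blk z ≡ B) (sym gu₀≡u) u∈B)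
    u₀∈ΓC : T (inΓ (blk x) u₀)
    u₀∈ΓC = inΓ-reflected g (subst (λ z → T (inΓ (blk (act g x)) z)) (sym gu₀≡u) u∈ΓgC)
    hu₀≡u : act h u₀ ≡ u
    hu₀≡u = trans (sym (g≈h u₀ u₀∈B)) gu₀≡u

  ≈B⇒≈N : (∀ C → T (qadj B C) → mD B C ≡ 1) →
          ∀ g h → Stab g → Stab h → g ≈B h → g ≈N h
  ≈B⇒≈N m≡1 g h g∈X_B h∈X_B g≈h x BC =
    determined-by-trace (m≡1 _ BhC) BhC BgC
      (trace-transport g∈X_B g≈h x) (trace-transport h∈X_B (λ u u∈B → sym (g≈h u u∈B)) x)
    where
    BgC = Γ𝓑B-preserved g g∈X_B x BC
    BhC = Γ𝓑B-preserved h h∈X_B x BC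

  -- A neighbour x of a vertex of B lies in B or in a block of Γ_𝓑(B); in
  -- both cases elements of X_B agreeing on Γ_𝓑(B) send it to the same block.
  same-block-on-neighbours : ∀ {g h} → Stab g → Stab h → g ≈N h →
                             ∀ {x u} → blk u ≡ B → T (adj x u) →
                             blk (act g x) ≡ blk (act h x)
  same-block-on-neighbours {g} {h} g∈X_B h∈X_B g≈h {x} {u} u∈B xu with blk x ≟ B
  ... | yes x∈B = trans (Equivalence.to (g∈X_B x) x∈B) (sym (Equivalence.to (h∈X_B x) x∈B))
  ... | no x∉B  = g≈h x (qadj-intro u u∈B (inΓ-intro refl xu) x∉B)

  ≈N⇒≈B : (∀ v → mStar v ≡ 1) →
          ∀ g h → Stab g → Stab h → g ≈N h → g ≈B h
  ≈N⇒≈B m*≡1 g h g∈X_B h∈X_B g≈h u u∈B =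
    sym (determined-by-Γ𝓑 (m*≡1 (act g u)) hu∼gu Γ𝓑gu⊆Γ𝓑hu)
    where
    hu∼gu : blk (act h u) ≡ blk (act g u)
    hu∼gu = trans (Equivalence.to (h∈X_B u) u∈B) (sym (Equivalence.to (g∈X_B u) u∈B))
    Γ𝓑gu⊆Γ𝓑hu : ∀ C → T (inΓ C (act g u)) → T (inΓ C (act h u))
    Γ𝓑gu⊆Γ𝓑hu C t with inΓ-elim t
    ... | y , y∈C , y~gu = inΓ-intro hx∈C (adj-preserved h xu)
      where
      x = act (g ⁻¹) y
      xu : T (adj x u)
      xu = subst (λ z → T (adj x z)) (act-inverseˡ g u) (adj-preserved (g ⁻¹) y~gu)
      hx∈C : blk (act h x) ≡ C
      hx∈C = trans (sym (same-block-on-neighbours g∈X_B h∈X_B g≈h u∈B xu))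
                   (trans (cong blk (act-inverseʳ g y)) y∈C)

theorem3p8 : {c ℓ : Level} {n k : ℕ} (Γ : SimpleGraph n) (X : Group c ℓ)
    (A : Action X n) (P : InvPartition X A k) → InG Γ X A P →
    (B : Fin k) →
    (∀ v → Quotient.mStar Γ (InvPartition.blk P) v ≡ 1) →
    (∀ C → T (Quotient.qadj Γ (InvPartition.blk P) B C) →
       Quotient.mD Γ (InvPartition.blk P) B C ≡ 1) →
    Induced.InducedIso Γ X A P B
theorem3p8 Γ X A P G B m*≡1 m≡1 = record
  { φ      = λ g → g
  ; φ-stab = λ _ g∈X_B → g∈X_B
  ; φ-cong = ≈B⇒≈N m≡1
  ; φ-hom  = λ _ _ _ _ _ _ → refl
  ; φ-inj  = ≈N⇒≈B m*≡1
  ; φ-surj = λ h h∈X_B → h , h∈X_B , λ _ _ → refl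
  }
  where open StabiliserAction Γ X A P (IsSymmetric.preserves (InG.symmetric G)) B
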